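{- Let $r \ge 2$ and let $\mathcal{H}_1=(V_1,\mathcal{E}_1),\ldots,\mathcal{H}_r=(V_r,\mathcal{E}_r)$ be 3-uniform hypergraphs, and let $G_i=(V_i,E_i)=EI(\mathcal{H}_i)$ for $i=1,\ldots,r$ (each $EI(\mathcal{H}_i)$ being a graph, since $\mathcal{H}_i$ is 3-uniform). Suppose that the graph $G=(V,E)=G_1\cup\cdots\cup G_r=(V_1\cup\cdots\cup V_r,\,E_1\cup\cdots\cup E_r)$ is the clique-fusion $G_1\oplus\cdots\oplus G_r$. Then the hypergraph $\mathcal{H}=\mathcal{H}_1\cup\cdots\cup\mathcal{H}_r=(V_1\cup\cdots\cup V_r,\ \mathcal{E}_1\cup\cdots\cup\mathcal{E}_r)$ is 3-uniform and $G=EI(\mathcal{H})$.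
   Context: All graphs and hypergraphs are finite, may have isolated vertices, and have no loops or multiple edges. A hypergraph $\mathcal{H}=(V,\mathcal{E})$ is $k$-uniform if every hyperedge has exactly $k$ vertices. The edge intersection hypergraph of $\mathcal{H}=(V,\mathcal{E})$ is $EI(\mathcal{H})=(V,\mathcal{E}^{EI})$ with $\mathcal{E}^{EI}=\{e_1\cap e_2 : e_1,e_2\in\mathcal{E},\ e_1\neq e_2,\ |e_1\cap e_2|\ge 2\}$; it has the same vertex set as $\mathcal{H}$, and when it is 2-uniform it is regarded as a simple graph; "$G=EI(\mathcal{H})$" means equality of vertex sets and of edge sets. Clique-fusion: given graphs $G_1=(V_1,E_1),\ldots,G_r=(V_r,E_r)$ with $r\ge 2$, let $V'=\{v : v\in V_i\cap V_j \text{ for some } i\neq j\}$ and assume $V'=\{v_1,\ldots,v_k\}$ with $k\ge 1$. If every two distinct vertices of $V'$ are adjacent in the union $G_1\cup\cdots\cup G_r$ (i.e. $V'$ induces a $k$-clique in the union), then the union $G_1\cup\cdots\cup G_r$ is called the clique-fusion (or $k$-fusion) of $G_1,\ldots,G_r$, written $G_1\oplus\cdots\oplus G_r$. -}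

module Defs where

open import Data.Nat using (ℕ; zero; suc; _≤_)
open import Data.Fin using (Fin; zero; suc)
open import Data.Fin.Subset using (Subset; _∈_; _⊆_; _∩_; _∪_; ⁅_⁆; ∣_∣) renaming (⊥ to ⊥ˢ)
open import Data.Fin.Subset.Properties using (p∩q⊆p; p⊆p∪q; q⊆p∪q)
open import Data.Product using (Σ; ∃; _×_; _,_)
open import Relation.Binary.PropositionalEquality using (_≡_; _≢_)
open import Function.Bundles using (_⇔_)

-- The edge set is a predicate on
-- Subset n (automatically finite, as Subset n is finite).  A simple graph is a 2-uniform hypergraph.
record Hypergraph (n : ℕ) : Set₁ where
  field
    vert   : Subset n
    edge   : Subset n → Set
    edge⊆  : ∀ e → edge e → e ⊆ vert
open Hypergraph public

Uniform : ∀ {n} → ℕ → Hypergraph n → Set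
Uniform k H = ∀ e → edge H e → ∣ e ∣ ≡ k

EIedge : ∀ {n} → Hypergraph n → Subset n → Set
EIedge H f = Σ (Subset _) λ e₁ → Σ (Subset _) λ e₂ →
  edge H e₁ × edge H e₂ × e₁ ≢ e₂ × f ≡ e₁ ∩ e₂ × 2 ≤ ∣ f ∣

EI : ∀ {n} → Hypergraph n → Hypergraph n
EI H = record
  { vert = vert H
  ; edge = EIedge H
  ; edge⊆ = λ { f (e₁ , e₂ , h₁ , h₂ , _ , _≡_.refl , _) x∈ →
                 edge⊆ H e₁ h₁ (x∩y⊆x' e₁ e₂ x∈) }
  }
  where
  x∩y⊆x' : ∀ {n} (a b : Subset n) → a ∩ b ⊆ a
  x∩y⊆x' a b = p∩q⊆p a b

⋃V : ∀ {n r} → (Fin r → Hypergraph n) → Subset n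
⋃V {r = zero}  H = ⊥ˢ
⋃V {r = suc r} H = vert (H zero) ∪ ⋃V (λ i → H (suc i))

∈⋃V : ∀ {n r} (H : Fin r → Hypergraph n) i {x} → x ∈ vert (H i) → x ∈ ⋃V H
∈⋃V {r = suc r} H zero    x∈ = p⊆p∪q _ x∈
∈⋃V {r = suc r} H (suc i) x∈ = q⊆p∪q _ _ (∈⋃V (λ j → H (suc j)) i x∈)

Union : ∀ {n r} → (Fin r → Hypergraph n) → Hypergraph n
Union {n} {r} H = record
  { vert = ⋃V H
  ; edge = λ f → ∃ λ i → edge (H i) f
  ; edge⊆ = λ { f (i , h) x∈ → ∈⋃V H i (edge⊆ (H i) f h x∈) }
  }

_≅_ : ∀ {n} → Hypergraph n → Hypergraph n → Set
G ≅ H = vert G ≡ vert H × (∀ f → edge G f ⇔ edge H f)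

Shared : ∀ {n r} → (Fin r → Hypergraph n) → Fin n → Set
Shared G v = Σ _ λ i → Σ _ λ j → i ≢ j × v ∈ vert (G i) × v ∈ vert (G j)

IsCliqueFusion : ∀ {n r} → (Fin r → Hypergraph n) → Set
IsCliqueFusion G =
  (∃ λ v → Shared G v) ×
  (∀ u v → Shared G u → Shared G v → u ≢ v → edge (Union G) (⁅ u ⁆ ∪ ⁅ v ⁆))

-- Inside one Hᵢ an intersection edge of the union is already an edge of Gᵢ.  Two
-- hyperedges from different Hᵢ ≠ Hⱼ are distinct 3-sets, so an intersection of
-- size ≥ 2 is a pair {u, v}; both vertices lie in Vᵢ ∩ Vⱼ, i.e. in the shared set
-- V′, and the clique-fusion hypothesis makes uv an edge of some Gₖ.
module Submission where

open import Defs
open import Data.Nat using (ℕ; zero; suc; _≤_; _<_; s≤s)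
import Data.Nat.Properties as ℕ
open import Data.Fin using (Fin; zero; suc)
open import Data.Fin.Properties using (suc-injective) renaming (_≟_ to _≟ᶠ_)
open import Data.Product using (_×_; _,_; Σ; ∃)
open import Data.Vec using ([]; _∷_; here)
open import Data.Fin.Subset using (Subset; _∈_; _⊆_; _∩_; _∪_; ⁅_⁆; ∣_∣; inside; outside)
  renaming (⊥ to ⊥ˢ)
open import Data.Fin.Subset.Properties
  using (drop-∷-⊆; p⊆q⇒∣p∣≤∣q∣; p∩q⊆p; p∩q⊆q; ∣p∩q∣≤∣p∣; x∈p∩q⁻; x∈⁅x⁆; p⊆p∪q; q⊆p∪q; ∪-identityˡ)
open import Data.Empty using (⊥-elim)
open import Relation.Nullary using (yes; no)
open import Relation.Binary.PropositionalEquality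
open import Function.Bundles using (mk⇔)

p⊆q∧∣q∣≤∣p∣⇒p≡q : ∀ {n} {p q : Subset n} → p ⊆ q → ∣ q ∣ ≤ ∣ p ∣ → p ≡ q
p⊆q∧∣q∣≤∣p∣⇒p≡q {p = []}          {q = []}          _   _   = refl
p⊆q∧∣q∣≤∣p∣⇒p≡q {p = outside ∷ p} {q = outside ∷ q} p⊆q q≤p =
  cong (outside ∷_) (p⊆q∧∣q∣≤∣p∣⇒p≡q (drop-∷-⊆ p⊆q) q≤p)
p⊆q∧∣q∣≤∣p∣⇒p≡q {p = outside ∷ p} {q = inside ∷ q}  p⊆q q≤p =
  ⊥-elim (ℕ.<-irrefl refl (ℕ.≤-trans (s≤s (p⊆q⇒∣p∣≤∣q∣ (drop-∷-⊆ p⊆q))) q≤p))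
p⊆q∧∣q∣≤∣p∣⇒p≡q {p = inside ∷ p}  {q = outside ∷ q} p⊆q _   with p⊆q here
... | ()
p⊆q∧∣q∣≤∣p∣⇒p≡q {p = inside ∷ p}  {q = inside ∷ q}  p⊆q q≤p =
  cong (inside ∷_) (p⊆q∧∣q∣≤∣p∣⇒p≡q (drop-∷-⊆ p⊆q) (ℕ.≤-pred q≤p))

∣p∣≡∣q∣∧p≢q⇒∣p∩q∣<∣p∣ : ∀ {n} (p q : Subset n) → ∣ p ∣ ≡ ∣ q ∣ → p ≢ q → ∣ p ∩ q ∣ < ∣ p ∣
∣p∣≡∣q∣∧p≢q⇒∣p∩q∣<∣p∣ p q ∣p∣≡∣q∣ p≢q = ℕ.≤∧≢⇒< (∣p∩q∣≤∣p∣ p q) ∣p∩q∣≢∣p∣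
  where
  ∣p∩q∣≢∣p∣ : ∣ p ∩ q ∣ ≢ ∣ p ∣
  ∣p∩q∣≢∣p∣ eq = p≢q (trans (sym (p⊆q∧∣q∣≤∣p∣⇒p≡q (p∩q⊆p p q) (ℕ.≤-reflexive (sym eq))))
                              (p⊆q∧∣q∣≤∣p∣⇒p≡q (p∩q⊆q p q) (ℕ.≤-reflexive (trans (sym ∣p∣≡∣q∣) (sym eq)))))

∣p∣≡0⇒p≡⊥ : ∀ {n} (p : Subset n) → ∣ p ∣ ≡ 0 → p ≡ ⊥ˢ
∣p∣≡0⇒p≡⊥ []            _  = refl
∣p∣≡0⇒p≡⊥ (outside ∷ p) eq = cong (outside ∷_) (∣p∣≡0⇒p≡⊥ p eq)

∣p∣≡1⇒p≡⁅x⁆ : ∀ {n} (p : Subset n) → ∣ p ∣ ≡ 1 → ∃ λ x → p ≡ ⁅ x ⁆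
∣p∣≡1⇒p≡⁅x⁆ (outside ∷ p) eq with ∣p∣≡1⇒p≡⁅x⁆ p eq
... | x , p≡⁅x⁆ = suc x , cong (outside ∷_) p≡⁅x⁆
∣p∣≡1⇒p≡⁅x⁆ (inside ∷ p)  eq = zero , cong (inside ∷_) (∣p∣≡0⇒p≡⊥ p (ℕ.suc-injective eq))

∣p∣≡2⇒p≡⁅x⁆∪⁅y⁆ : ∀ {n} (p : Subset n) → ∣ p ∣ ≡ 2 →
  Σ (Fin n) λ x → Σ (Fin n) λ y → x ≢ y × p ≡ ⁅ x ⁆ ∪ ⁅ y ⁆
∣p∣≡2⇒p≡⁅x⁆∪⁅y⁆ (outside ∷ p) eq with ∣p∣≡2⇒p≡⁅x⁆∪⁅y⁆ p eq
... | x , y , x≢y , p≡xy = suc x , suc y , (λ sx≡sy → x≢y (suc-injective sx≡sy)) , cong (outside ∷_) p≡xy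
∣p∣≡2⇒p≡⁅x⁆∪⁅y⁆ (inside ∷ p)  eq with ∣p∣≡1⇒p≡⁅x⁆ p (ℕ.suc-injective eq)
... | y , p≡⁅y⁆ = zero , suc y , (λ ()) , cong (inside ∷_) (trans p≡⁅y⁆ (sym (∪-identityˡ ⁅ y ⁆)))

∣p∣≡∣q∣≡1+k∧k≤∣p∩q∣⇒∣p∩q∣≡k : ∀ {n k} (p q : Subset n) → ∣ p ∣ ≡ suc k → ∣ q ∣ ≡ suc k →
  p ≢ q → k ≤ ∣ p ∩ q ∣ → ∣ p ∩ q ∣ ≡ k
∣p∣≡∣q∣≡1+k∧k≤∣p∩q∣⇒∣p∩q∣≡k p q ∣p∣≡1+k ∣q∣≡1+k p≢q k≤ = ℕ.≤-antisym
  (ℕ.≤-pred (subst (∣ p ∩ q ∣ <_) ∣p∣≡1+k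
    (∣p∣≡∣q∣∧p≢q⇒∣p∩q∣<∣p∣ p q (trans ∣p∣≡1+k (sym ∣q∣≡1+k)) p≢q)))
  k≤

⋃V-cong : ∀ {n r} (G H : Fin r → Hypergraph n) → (∀ i → vert (G i) ≡ vert (H i)) → ⋃V G ≡ ⋃V H
⋃V-cong {r = zero}  G H eq = refl
⋃V-cong {r = suc r} G H eq = cong₂ _∪_ (eq zero) (⋃V-cong (λ i → G (suc i)) (λ i → H (suc i)) (λ i → eq (suc i)))

Union-uniform : ∀ {n r k} (H : Fin r → Hypergraph n) → (∀ i → Uniform k (H i)) → Uniform k (Union H)
Union-uniform H U e (i , e∈Hᵢ) = U i e e∈Hᵢ

Union-EI⊆EI-Union : ∀ {n r} (H : Fin r → Hypergraph n) f →
  edge (Union (λ i → EI (H i))) f → EIedge (Union H) f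
Union-EI⊆EI-Union H f (i , e₁ , e₂ , e₁∈ , e₂∈ , e₁≢e₂ , f≡ , 2≤) =
  e₁ , e₂ , (i , e₁∈) , (i , e₂∈) , e₁≢e₂ , f≡ , 2≤

∈∩⇒Shared : ∀ {n r} (H : Fin r → Hypergraph n) {i j e₁ e₂ x} → i ≢ j →
  edge (H i) e₁ → edge (H j) e₂ → x ∈ e₁ ∩ e₂ → Shared (λ i → EI (H i)) x
∈∩⇒Shared H {i} {j} {e₁} {e₂} i≢j e₁∈ e₂∈ x∈ with x∈p∩q⁻ e₁ e₂ x∈
... | x∈e₁ , x∈e₂ = i , j , i≢j , edge⊆ (H i) e₁ e₁∈ x∈e₁ , edge⊆ (H j) e₂ e₂∈ x∈e₂

EI-Union⊆Union-EI : ∀ {n r} (H : Fin r → Hypergraph n) → (∀ i → Uniform 3 (H i)) →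
  IsCliqueFusion (λ i → EI (H i)) →
  ∀ f → EIedge (Union H) f → edge (Union (λ i → EI (H i))) f
EI-Union⊆Union-EI H U (_ , clique) f (e₁ , e₂ , (i , e₁∈) , (j , e₂∈) , e₁≢e₂ , refl , 2≤)
  with i ≟ᶠ j
... | yes refl = i , e₁ , e₂ , e₁∈ , e₂∈ , e₁≢e₂ , refl , 2≤
... | no i≢j
  with ∣p∣≡2⇒p≡⁅x⁆∪⁅y⁆ (e₁ ∩ e₂)
         (∣p∣≡∣q∣≡1+k∧k≤∣p∩q∣⇒∣p∩q∣≡k e₁ e₂ (U i e₁ e₁∈) (U j e₂ e₂∈) e₁≢e₂ 2≤)
...   | u , v , u≢v , f≡uv with clique u v (shared u (p⊆p∪q ⁅ v ⁆ (x∈⁅x⁆ u)))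
                                             (shared v (q⊆p∪q ⁅ u ⁆ ⁅ v ⁆ (x∈⁅x⁆ v))) u≢v
  where
  shared : ∀ x → x ∈ ⁅ u ⁆ ∪ ⁅ v ⁆ → Shared (λ i → EI (H i)) x
  shared x x∈uv = ∈∩⇒Shared H i≢j e₁∈ e₂∈ (subst (x ∈_) (sym f≡uv) x∈uv)
...     | k , uv∈Gₖ = k , subst (EIedge (H k)) (sym f≡uv) uv∈Gₖ

theorem3 : (n r : ℕ) → 2 ≤ r → (H : Fin r → Hypergraph n) →
    (∀ i → Uniform 3 (H i)) →
    IsCliqueFusion (λ i → EI (H i)) →
    Uniform 3 (Union H) × (Union (λ i → EI (H i)) ≅ EI (Union H))
theorem3 n r _ H U fusion =
  Union-uniform H U ,
  ⋃V-cong (λ i → EI (H i)) H (λ _ → refl) ,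
  λ f → mk⇔ (Union-EI⊆EI-Union H f) (EI-Union⊆Union-EI H U fusion f)
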